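{- Let $H=(V,E)$ be a $(k,l)$-edge-maximal $r$-uniform hypergraph with $k,r\geq 2$ and $n\geq l\geq t+1$, where $n=|V|$ and $t=t(k,r)$. Let $X$ be a proper nonempty subset of $V$ with $|E_H(X)|=k$. Then: (i) if $|X|\leq r-1$, then $H[X]$ has no edges and every edge of $E_H(X)$ contains $X$; (ii) if $r\leq |X|\leq l-1$, then $H[X]$ is a complete $r$-uniform hypergraph and $|X|\geq t$; (iii) if $|X|\geq l$, then $H[X]$ is a $(k,l)$-edge-maximal $r$-uniform hypergraph.
   Context: A hypergraph $H=(V,E)$ has a finite vertex set $V$ and a set $E$ of nonempty subsets of $V$; it is $r$-uniform if every edge has exactly $r$ elements. $H[X]$ is the induced subhypergraph with vertex set $X$ and edge set $\{e\in E: e\subseteq X\}$. A subhypergraph $H'=(V',E')$ of $H$ has $V'\subseteq V$, $E'\subseteq E$ (each edge of $E'$ contained in $V'$). For $X\subseteq V$, $E_H(X)$ is the set of edges of $H$ meeting both $X$ and $V\setminus X$ and $d_H(X)=|E_H(X)|$; $\kappa'(H)=\min\{d_H(X):\emptyset\neq X\subsetneq V\}$. For an $r$-subset $e\notin E$ of $V$, $H+e=(V,E\cup\{e\})$. An $r$-uniform hypergraph $H$ is $(k,l)$-edge-maximal if every subhypergraph $H'$ with $|V(H')|\geq l$ has $\kappa'(H')\leq k$, but for every $r$-subset $e$ of $V(H)$ not in $E(H)$, $H+e$ has a subhypergraph $H''$ with $|V(H'')|\geq l$ and $\kappa'(H'')\geq k+1$. For $k,r\geq2$, $t=t(k,r)$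 is the integer with $\binom{t-1}{r-1}\leq k<\binom{t}{r-1}$. -}

module Defs where

open import Data.Nat using (ℕ; zero; suc; _≤_; _<_; _∸_)
open import Data.Nat.Combinatorics using (_C_)
open import Data.Bool using (Bool; true; false; _∧_; _∨_)
open import Data.Vec using (Vec; []; _∷_)
open import Data.Vec.Properties using (≡-dec)
open import Data.List using (List; []; _∷_; map; _++_; filter; length)
open import Data.Fin.Subset using (Subset; _⊆_; _∩_; _─_; ∣_∣; Nonempty; inside; outside)
open import Data.Fin.Subset.Properties using (nonempty?; _⊆?_)
open import Data.Product using (Σ; _×_; ∃)
open import Relation.Nullary using (¬_)
open import Relation.Nullary.Decidable using (isYes; _×-dec_)
open import Relation.Binary.PropositionalEquality using (_≡_)
import Data.Bool as B

allSubsets : (m : ℕ) → List (Subset m)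
allSubsets zero = [] ∷ []
allSubsets (suc m) = map (outside ∷_) (allSubsets m) ++ map (inside ∷_) (allSubsets m)

-- Well-formedness (edges are
-- nonempty subsets of V) and r-uniformity are the predicate below.
record Hypergraph (m : ℕ) : Set where
  constructor hg
  field
    V : Subset m
    E : Subset m → Bool
open Hypergraph public

Uniform : {m : ℕ} → ℕ → Hypergraph m → Set
Uniform r H = ∀ e → E H e ≡ true → (e ⊆ V H) × (∣ e ∣ ≡ r) × Nonempty e

edges : {m : ℕ} → Hypergraph m → List (Subset m)
edges {m} H = filter (λ e → E H e B.≟ true) (allSubsets m)

crosses : {m : ℕ} → Hypergraph m → Subset m → Subset m → Bool
crosses H X e = isYes (nonempty? (e ∩ X) ×-dec nonempty? (e ∩ (V H ─ X)))

d : {m : ℕ} → Hypergraph m → Subset m → ℕ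
d H X = length (filter (λ e → crosses H X e B.≟ true) (edges H))

ProperNonempty : {m : ℕ} → Hypergraph m → Subset m → Set
ProperNonempty H X = X ⊆ V H × Nonempty X × Nonempty (V H ─ X)

-- κ'(H) ≤ k : some proper nonempty X has d_H(X) ≤ k
-- (κ' is a minimum over such X; for |V| ≤ 1 it is +∞ by convention)
κ'≤ : {m : ℕ} → Hypergraph m → ℕ → Set
κ'≤ H k = Σ (Subset _) λ X → ProperNonempty H X × d H X ≤ k

κ'≥ : {m : ℕ} → Hypergraph m → ℕ → Set
κ'≥ H k = ∀ X → ProperNonempty H X → k ≤ d H X

Sub : {m : ℕ} → Hypergraph m → Hypergraph m → Set
Sub H' H = (V H' ⊆ V H) × (∀ e → E H' e ≡ true → (E H e ≡ true) × (e ⊆ V H'))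

addEdge : {m : ℕ} → Hypergraph m → Subset m → Hypergraph m
addEdge H e = hg (V H) (λ x → E H x ∨ isYes (≡-dec B._≟_ x e))

induced : {m : ℕ} → Hypergraph m → Subset m → Hypergraph m
induced H X = hg X (λ e → E H e ∧ isYes (e ⊆? X))

EdgeMaximal : {m : ℕ} → ℕ → ℕ → ℕ → Hypergraph m → Set
EdgeMaximal k l r H =
  Uniform r H
  × (∀ H' → Sub H' H → l ≤ ∣ V H' ∣ → κ'≤ H' k)
  × (∀ e → e ⊆ V H → ∣ e ∣ ≡ r → E H e ≡ false →
       Σ (Hypergraph _) λ H'' → Sub H'' (addEdge H e) × l ≤ ∣ V H'' ∣ × κ'≥ H'' (suc k))

IsT : ℕ → ℕ → ℕ → Set
IsT k r t = ((t ∸ 1) C (r ∸ 1) ≤ k) × (k < t C (r ∸ 1))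

module Submission where

-- Adding a missing r-set e to H creates a subhypergraph H'' of H + e with at least l vertices and
-- κ'(H'') ≥ k + 1; by maximality H'' contains e.  Cutting off a vertex of e in H'' shows that every
-- vertex of H has degree at least k, and for |X| < r this forces every edge crossing X to contain
-- all of X.  If e ⊆ X, then X ∩ V(H'') is a cut of H'' with at most d_H(X) = k crossing edges
-- unless V(H'') ⊆ X; hence X is complete when |X| < l, and H[X] inherits edge-maximality when
-- |X| ≥ l.  Finally, if X is complete and |X| < t, double counting gives
-- Σ_{x∈X} deg x ≤ r·C(|X|,r) + (r−1)k ≤ |X|·k, using C(|X|,r−1) ≤ C(t−1,r−1) ≤ k; but every
-- vertex of X has degree ≥ k and some vertex of X has degree > k.

open import Defs
open import Data.Nat
  using (ℕ; zero; suc; pred; _+_; _*_; _∸_; _≤_; _<_; z≤n; s≤s; s≤s⁻¹; _≤′_; ≤′-refl; ≤′-step; >-nonZero)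
open import Data.Nat.Properties
open import Data.Nat.Combinatorics using (_C_; nC1≡n; nCk+nC[k+1]≡[n+1]C[k+1])
open import Data.Nat.ListAction using (sum)
open import Data.Nat.ListAction.Properties using (sum-++)
open import Data.Nat.Tactic.RingSolver using (solve-∀)
open import Algebra.Properties.CommutativeSemigroup +-commutativeSemigroup using (interchange)
open import Data.Bool using (Bool; true; false; _∧_; _∨_; not; if_then_else_)
open import Data.Bool.Properties using (∧-zeroʳ; ∧-identityʳ; ∨-zeroʳ; ¬-not)
import Data.Bool as B
open import Data.List using (List; []; _∷_; map; _++_; filter; length)
open import Data.List.Properties using (map-++; map-∘; map-cong)
open import Data.List.Membership.Propositional using () renaming (_∈_ to _∈ˡ_)
open import Data.List.Membership.Propositional.Properties using (∈-++⁺ˡ; ∈-++⁺ʳ; ∈-map⁺)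
open import Data.List.Relation.Unary.Any using (here; there)
open import Data.Fin using (Fin; zero; suc)
open import Data.Fin.Subset using (Subset; _⊆_; ∣_∣; _∈_; _∉_; _∩_; _─_; ⁅_⁆; Nonempty; inside; outside)
open import Data.Fin.Subset.Properties
open import Data.Vec using ([]; _∷_; lookup; here; there)
open import Data.Vec.Properties using (≡-dec; []=⇒lookup; lookup⇒[]=)
open import Data.Sum using (_⊎_; inj₁; inj₂)
open import Data.Product using (Σ; ∃; _×_; _,_; proj₁; proj₂)
open import Data.Empty using (⊥-elim)
open import Function using (_∘_)
open import Relation.Nullary using (¬_; Dec; yes; no; does; contradiction)
open import Relation.Nullary.Decidable using (isYes; _×-dec_; dec-false)
open import Relation.Binary.PropositionalEquality
  using (_≡_; refl; sym; trans; cong; cong₂; subst; module ≡-Reasoning)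

∧-true⁻ : ∀ a {b} → a ∧ b ≡ true → a ≡ true × b ≡ true
∧-true⁻ true {true} _ = refl , refl

∧-true⁺ : ∀ {a b} → a ≡ true → b ≡ true → a ∧ b ≡ true
∧-true⁺ refl refl = refl

∨-true⁻ : ∀ {a b} → a ∨ b ≡ true → a ≡ true ⊎ b ≡ true
∨-true⁻ {true}  _   = inj₁ refl
∨-true⁻ {false} b≡t = inj₂ b≡t

isYes⁻ : ∀ {P : Set} (P? : Dec P) → isYes P? ≡ true → P
isYes⁻ (yes p) _ = p

isYes⁺ : ∀ {P : Set} (P? : Dec P) → P → isYes P? ≡ true
isYes⁺ (yes _)  _ = refl
isYes⁺ (no ¬p) p = contradiction p ¬p

does⁻ : ∀ {P : Set} (P? : Dec P) → does P? ≡ true → P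
does⁻ (yes p) _ = p

does⁺ : ∀ {P : Set} (P? : Dec P) → P → does P? ≡ true
does⁺ (yes _)  _ = refl
does⁺ (no ¬p) p = contradiction p ¬p

boolToℕ : Bool → ℕ
boolToℕ true  = 1
boolToℕ false = 0

module _ {A : Set} where

  ∑ : (A → ℕ) → List A → ℕ
  ∑ w xs = sum (map w xs)

  count : (A → Bool) → List A → ℕ
  count p = ∑ (boolToℕ ∘ p)

  ∑-mono-≤ : ∀ {v w : A → ℕ} → (∀ x → v x ≤ w x) → ∀ xs → ∑ v xs ≤ ∑ w xs
  ∑-mono-≤ v≤w []       = z≤n
  ∑-mono-≤ v≤w (x ∷ xs) = +-mono-≤ (v≤w x) (∑-mono-≤ v≤w xs)

  ∑-+ : ∀ (v w : A → ℕ) xs → ∑ (λ x → v x + w x) xs ≡ ∑ v xs + ∑ w xs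
  ∑-+ v w []       = refl
  ∑-+ v w (x ∷ xs) =
    trans (cong (v x + w x +_) (∑-+ v w xs)) (interchange (v x) (w x) (∑ v xs) (∑ w xs))

  ∑-* : ∀ a (w : A → ℕ) xs → ∑ (λ x → a * w x) xs ≡ a * ∑ w xs
  ∑-* a w []       = sym (*-zeroʳ a)
  ∑-* a w (x ∷ xs) = trans (cong (a * w x +_) (∑-* a w xs)) (sym (*-distribˡ-+ a (w x) (∑ w xs)))

  count-cong : ∀ {p q : A → Bool} → (∀ x → p x ≡ q x) → ∀ xs → count p xs ≡ count q xs
  count-cong p≡q xs = cong sum (map-cong (cong boolToℕ ∘ p≡q) xs)

  count-false : ∀ {p : A → Bool} → (∀ x → p x ≡ false) → ∀ xs → count p xs ≡ 0
  count-false p≡f []       = refl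
  count-false p≡f (x ∷ xs) rewrite p≡f x = count-false p≡f xs

  count-mono : ∀ {p q : A → Bool} → (∀ x → p x ≡ true → q x ≡ true) → ∀ xs → count p xs ≤ count q xs
  count-mono {p} {q} p⇒q = ∑-mono-≤ pointwise
    where
    pointwise : ∀ x → boolToℕ (p x) ≤ boolToℕ (q x)
    pointwise x with p x in px
    ... | false = z≤n
    ... | true rewrite p⇒q x px = ≤-refl

  count-∨ : ∀ (p q : A → Bool) xs → count (λ x → p x ∨ q x) xs ≤ count p xs + count q xs
  count-∨ p q xs = ≤-trans (∑-mono-≤ pointwise xs) (≤-reflexive (∑-+ (boolToℕ ∘ p) (boolToℕ ∘ q) xs))
    where
    pointwise : ∀ x → boolToℕ (p x ∨ q x) ≤ boolToℕ (p x) + boolToℕ (q x)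
    pointwise x with p x | q x
    ... | true  | _ = s≤s z≤n
    ... | false | _ = ≤-refl

  count-split : ∀ (p q : A → Bool) xs →
                count p xs ≡ count (λ x → p x ∧ q x) xs + count (λ x → p x ∧ not (q x)) xs
  count-split p q xs = trans (cong sum (map-cong pointwise xs)) (∑-+ _ _ xs)
    where
    pointwise : ∀ x → boolToℕ (p x) ≡ boolToℕ (p x ∧ q x) + boolToℕ (p x ∧ not (q x))
    pointwise x with p x | q x
    ... | true  | true  = refl
    ... | true  | false = refl
    ... | false | _     = refl

  count-≤⇒converse : ∀ {p q : A → Bool} xs → (∀ x → p x ≡ true → q x ≡ true) →
                     count q xs ≤ count p xs → ∀ {x} → x ∈ˡ xs → q x ≡ true → p x ≡ true
  count-≤⇒converse {p} {q} (y ∷ xs) p⇒q q≤p x∈ qx with p y in py | q y in qy | x∈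
  ... | true  | false | _          = contradiction (trans (sym (p⇒q y py)) qy) λ ()
  ... | false | true  | _          = contradiction (≤-trans q≤p (count-mono p⇒q xs)) (n≮n _)
  ... | true  | true  | here refl  = py
  ... | false | false | here refl  = contradiction (trans (sym qx) qy) λ ()
  ... | true  | true  | there x∈xs = count-≤⇒converse xs p⇒q (s≤s⁻¹ q≤p) x∈xs qx
  ... | false | false | there x∈xs = count-≤⇒converse xs p⇒q q≤p x∈xs qx

  length-filter≡count : ∀ (p : A → Bool) xs → length (filter (λ x → p x B.≟ true) xs) ≡ count p xs
  length-filter≡count p []       = refl
  length-filter≡count p (x ∷ xs) with p x
  ... | true  = cong suc (length-filter≡count p xs)
  ... | false = length-filter≡count p xs

  count-filter : ∀ (p q : A → Bool) xs → count q (filter (λ x → p x B.≟ true) xs) ≡ count (λ x → p x ∧ q x) xs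
  count-filter p q []       = refl
  count-filter p q (x ∷ xs) with p x
  ... | true  = cong (boolToℕ (q x) +_) (count-filter p q xs)
  ... | false = count-filter p q xs

-- Subsets of Fin m

x∈p─q⇒x∉q : ∀ {m} {x : Fin m} (p q : Subset m) → x ∈ p ─ q → x ∉ q
x∈p─q⇒x∉q (_ ∷ p) (outside ∷ q) here          = λ ()
x∈p─q⇒x∉q (_ ∷ p) (_       ∷ q) (there x∈p─q) = λ { (there x∈q) → x∈p─q⇒x∉q p q x∈p─q x∈q }

Empty[p─q]⇒p⊆q : ∀ {m} {p q : Subset m} → ¬ Nonempty (p ─ q) → p ⊆ q
Empty[p─q]⇒p⊆q {q = q} empty {x} x∈p with x ∈? q
... | yes x∈q = x∈q
... | no  x∉q = contradiction (x , x∈p∧x∉q⇒x∈p─q x∈p x∉q) empty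

p⊈q⇒∃∈p∉q : ∀ {m} {p q : Subset m} → ¬ (p ⊆ q) → ∃ λ x → x ∈ p × x ∉ q
p⊈q⇒∃∈p∉q {p = p} {q} p⊈q with nonempty? (p ─ q)
... | yes (x , x∈p─q) = x , p─q⊆p p q x∈p─q , x∈p─q⇒x∉q p q x∈p─q
... | no  empty       = ⊥-elim (p⊈q (Empty[p─q]⇒p⊆q empty))

∣q∣<∣p∣⇒∃∈p∉q : ∀ {m} {p q : Subset m} → ∣ q ∣ < ∣ p ∣ → ∃ λ x → x ∈ p × x ∉ q
∣q∣<∣p∣⇒∃∈p∉q ∣q∣<∣p∣ = p⊈q⇒∃∈p∉q λ p⊆q → <⇒≱ ∣q∣<∣p∣ (p⊆q⇒∣p∣≤∣q∣ p⊆q)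

x∈p⇒0<∣p∣ : ∀ {m} {x : Fin m} {p : Subset m} → x ∈ p → 0 < ∣ p ∣
x∈p⇒0<∣p∣ {x = x} x∈p = subst (_≤ _) (∣⁅x⁆∣≡1 x) (p⊆q⇒∣p∣≤∣q∣ λ y∈⁅x⁆ → subst (_∈ _) (sym (x∈⁅y⁆⇒x≡y x y∈⁅x⁆)) x∈p)

Empty⇒∣p∣≡0 : ∀ {m} {p : Subset m} → ¬ Nonempty p → ∣ p ∣ ≡ 0
Empty⇒∣p∣≡0 {m} empty = trans (cong ∣_∣ (Empty-unique empty)) (∣⊥∣≡0 m)

0<∣p∣⇒Nonempty : ∀ {m} {p : Subset m} → 0 < ∣ p ∣ → Nonempty p
0<∣p∣⇒Nonempty {p = p} 0<∣p∣ with nonempty? p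
... | yes ne    = ne
... | no  empty = contradiction (Empty⇒∣p∣≡0 empty) (>⇒≢ 0<∣p∣)

∈-allSubsets : ∀ {m} (s : Subset m) → s ∈ˡ allSubsets m
∈-allSubsets []                    = here refl
∈-allSubsets {suc m} (outside ∷ s) = ∈-++⁺ˡ (∈-map⁺ (outside ∷_) (∈-allSubsets s))
∈-allSubsets {suc m} (inside  ∷ s) =
  ∈-++⁺ʳ (map (outside ∷_) (allSubsets m)) (∈-map⁺ (inside ∷_) (∈-allSubsets s))

∑-allSubsets-suc : ∀ {m} (w : Subset (suc m) → ℕ) →
                   ∑ w (allSubsets (suc m)) ≡ ∑ (w ∘ (outside ∷_)) (allSubsets m) + ∑ (w ∘ (inside ∷_)) (allSubsets m)
∑-allSubsets-suc {m} w = begin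
  sum (map w (map (outside ∷_) S ++ map (inside ∷_) S))         ≡⟨ cong sum (map-++ w (map (outside ∷_) S) _) ⟩
  sum (map w (map (outside ∷_) S) ++ map w (map (inside ∷_) S)) ≡⟨ sum-++ (map w (map (outside ∷_) S)) _ ⟩
  ∑ w (map (outside ∷_) S) + ∑ w (map (inside ∷_) S)            ≡⟨ cong₂ (λ a b → sum a + sum b) (map-∘ S) (map-∘ S) ⟨
  ∑ (w ∘ (outside ∷_)) S + ∑ (w ∘ (inside ∷_)) S                ∎
  where
  open ≡-Reasoning
  S = allSubsets m

count-allSubsets-suc : ∀ {m} (p : Subset (suc m) → Bool) →
                       count p (allSubsets (suc m)) ≡
                       count (p ∘ (outside ∷_)) (allSubsets m) + count (p ∘ (inside ∷_)) (allSubsets m)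
count-allSubsets-suc p = ∑-allSubsets-suc (boolToℕ ∘ p)

count-≡-allSubsets : ∀ {m} (e : Subset m) → count (λ s → does (≡-dec B._≟_ s e)) (allSubsets m) ≡ 1
count-≡-allSubsets []                    = refl
count-≡-allSubsets {suc m} (outside ∷ e) =
  trans (count-allSubsets-suc (λ s → does (≡-dec B._≟_ s (outside ∷ e))))
        (cong₂ _+_ (count-≡-allSubsets e) (count-false (λ _ → refl) (allSubsets m)))
count-≡-allSubsets {suc m} (inside ∷ e)  =
  trans (count-allSubsets-suc (λ s → does (≡-dec B._≟_ s (inside ∷ e))))
        (cong₂ _+_ (count-false (λ _ → refl) (allSubsets m)) (count-≡-allSubsets e))

count-≤-+1 : ∀ {m} {p q : Subset m → Bool} (e : Subset m) → (∀ f → p f ≡ true → q f ≡ true ⊎ f ≡ e) →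
             count p (allSubsets m) ≤ count q (allSubsets m) + 1
count-≤-+1 {m} {p} {q} e p⇒q∨e = begin
  count p S                                              ≤⟨ count-mono pointwise S ⟩
  count (λ f → q f ∨ does (≡-dec B._≟_ f e)) S           ≤⟨ count-∨ q _ S ⟩
  count q S + count (λ f → does (≡-dec B._≟_ f e)) S     ≡⟨ cong (count q S +_) (count-≡-allSubsets e) ⟩
  count q S + 1                                          ∎
  where
  open ≤-Reasoning
  S = allSubsets m
  pointwise : ∀ f → p f ≡ true → q f ∨ does (≡-dec B._≟_ f e) ≡ true
  pointwise f pf with p⇒q∨e f pf
  ... | inj₁ qf   rewrite qf = refl
  ... | inj₂ refl rewrite does⁺ (≡-dec B._≟_ f f) refl = ∨-zeroʳ (q f)

inChoose : ∀ {m} → Subset m → ℕ → Subset m → Bool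
inChoose A r s = does (s ⊆? A) ∧ does (∣ s ∣ ≟ r)

inChoose⁻ : ∀ {m} {A : Subset m} {r s} → inChoose A r s ≡ true → s ⊆ A × ∣ s ∣ ≡ r
inChoose⁻ {A = A} {r} {s} h with ∧-true⁻ (does (s ⊆? A)) h
... | s⊆A , ∣s∣≡r = does⁻ (s ⊆? A) s⊆A , does⁻ (∣ s ∣ ≟ r) ∣s∣≡r

count-inChoose : ∀ {m} (A : Subset m) r → count (inChoose A r) (allSubsets m) ≡ ∣ A ∣ C r
count-inChoose []                    zero    = refl
count-inChoose []                    (suc r) = refl
count-inChoose {suc m} (outside ∷ A) r       =
  trans (count-allSubsets-suc (inChoose (outside ∷ A) r))
        (trans (cong₂ _+_ (count-inChoose A r) (count-false (λ _ → refl) (allSubsets m))) (+-identityʳ _))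
count-inChoose {suc m} (inside ∷ A)  zero    =
  trans (count-allSubsets-suc (inChoose (inside ∷ A) zero))
        (cong₂ _+_ (count-inChoose A zero) (count-false (λ s → ∧-zeroʳ (does (s ⊆? A))) (allSubsets m)))
count-inChoose {suc m} (inside ∷ A)  (suc r) =
  trans (count-allSubsets-suc (inChoose (inside ∷ A) (suc r)))
        (trans (cong₂ _+_ (count-inChoose A (suc r)) (count-inChoose A r))
               (trans (+-comm (∣ A ∣ C suc r) _) (nCk+nC[k+1]≡[n+1]C[k+1] ∣ A ∣ r)))

count-inChoose-∋ : ∀ {m} (A : Subset m) r {y} → y ∈ A →
                   count (λ s → inChoose A (suc r) s ∧ lookup s y) (allSubsets m) ≡ pred ∣ A ∣ C r
count-inChoose-∋ {suc m} (inside ∷ A) r {zero} here =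
  trans (count-allSubsets-suc (λ s → inChoose (inside ∷ A) (suc r) s ∧ lookup s zero))
        (cong₂ _+_ (count-false (λ s → ∧-zeroʳ _) (allSubsets m))
                   (trans (count-cong (λ s → ∧-identityʳ _) (allSubsets m)) (count-inChoose A r)))
count-inChoose-∋ {suc m} (outside ∷ A) r {suc y} (there y∈A) =
  trans (count-allSubsets-suc (λ s → inChoose (outside ∷ A) (suc r) s ∧ lookup s (suc y)))
        (trans (cong₂ _+_ (count-inChoose-∋ A r y∈A) (count-false (λ _ → refl) (allSubsets m))) (+-identityʳ _))
count-inChoose-∋ {suc m} (inside ∷ A) zero {suc y} (there y∈A) =
  trans (count-allSubsets-suc (λ s → inChoose (inside ∷ A) 1 s ∧ lookup s (suc y)))
        (trans (cong₂ _+_ (count-inChoose-∋ A zero y∈A) (count-false no-empty-∋y (allSubsets m))) (+-identityʳ _))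
  where
  no-empty-∋y : ∀ s → inChoose A zero s ∧ lookup s y ≡ false
  no-empty-∋y s with lookup s y in y∈s
  ... | false = ∧-zeroʳ _
  ... | true  rewrite dec-false (∣ s ∣ ≟ 0) (>⇒≢ (x∈p⇒0<∣p∣ (lookup⇒[]= y s y∈s))) =
    trans (∧-identityʳ _) (∧-zeroʳ (does (s ⊆? A)))
count-inChoose-∋ {suc m} (inside ∷ A) (suc r) {suc y} (there y∈A) =
  trans (count-allSubsets-suc (λ s → inChoose (inside ∷ A) (suc (suc r)) s ∧ lookup s (suc y)))
        (trans (cong₂ _+_ (count-inChoose-∋ A (suc r) y∈A) (count-inChoose-∋ A r y∈A))
               (trans (+-comm (pred ∣ A ∣ C suc r) _)
                      (trans (nCk+nC[k+1]≡[n+1]C[k+1] (pred ∣ A ∣) r)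
                             (cong (_C suc r) (suc-pred ∣ A ∣ {{>-nonZero (x∈p⇒0<∣p∣ y∈A)}})))))

-- Binomial coefficients

nCk≤[n+1]Ck : ∀ n k → n C k ≤ suc n C k
nCk≤[n+1]Ck n zero    = ≤-refl
nCk≤[n+1]Ck n (suc k) = ≤-trans (m≤n+m (n C suc k) (n C k)) (≤-reflexive (nCk+nC[k+1]≡[n+1]C[k+1] n k))

C-monoˡ-≤ : ∀ k {a b} → a ≤ b → a C k ≤ b C k
C-monoˡ-≤ k {a} a≤b = go (≤⇒≤′ a≤b)
  where
  go : ∀ {b} → a ≤′ b → a C k ≤ b C k
  go ≤′-refl        = ≤-refl
  go (≤′-step a≤′b) = ≤-trans (go a≤′b) (nCk≤[n+1]Ck _ k)

k≤n⇒0<nCk : ∀ {n} k → k ≤ n → 0 < n C k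
k≤n⇒0<nCk zero    _         = s≤s z≤n
k≤n⇒0<nCk {suc n} (suc k) (s≤s k≤n) =
  ≤-trans (k≤n⇒0<nCk k k≤n) (≤-trans (m≤m+n (n C k) _) (≤-reflexive (nCk+nC[k+1]≡[n+1]C[k+1] n k)))

-- (k+1) C(n,k+1) = (n−k) C(n,k), with the subtraction moved to the other side.
[k+1]*nC[k+1]+k*nCk≡n*nCk : ∀ n k → suc k * (n C suc k) + k * (n C k) ≡ n * (n C k)
[k+1]*nC[k+1]+k*nCk≡n*nCk zero    zero    = refl
[k+1]*nC[k+1]+k*nCk≡n*nCk zero    (suc k) = cong₂ _+_ (*-zeroʳ (suc (suc k))) (*-zeroʳ (suc k))
[k+1]*nC[k+1]+k*nCk≡n*nCk (suc n) zero    = begin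
  1 * (suc n C 1) + 0  ≡⟨ +-identityʳ _ ⟩
  1 * (suc n C 1)      ≡⟨ *-identityˡ _ ⟩
  suc n C 1            ≡⟨ nC1≡n (suc n) ⟩
  suc n                ≡⟨ *-identityʳ (suc n) ⟨
  suc n * 1            ∎
  where open ≡-Reasoning
[k+1]*nC[k+1]+k*nCk≡n*nCk (suc n) (suc k) = begin
  suc (suc k) * (suc n C suc (suc k)) + suc k * (suc n C suc k)
    ≡⟨ cong₂ (λ x y → suc (suc k) * x + suc k * y) (pascal n (suc k)) (pascal n k) ⟨
  suc (suc k) * (b + c) + suc k * (a + b)
    ≡⟨ regroup k a b c ⟩
  (suc (suc k) * c + suc k * b) + (suc k * b + k * a) + (a + b)
    ≡⟨ cong₂ (λ x y → x + y + (a + b)) ([k+1]*nC[k+1]+k*nCk≡n*nCk n (suc k)) ([k+1]*nC[k+1]+k*nCk≡n*nCk n k) ⟩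
  n * b + n * a + (a + b)
    ≡⟨ collect n a b ⟩
  suc n * (a + b)
    ≡⟨ cong (suc n *_) (pascal n k) ⟩
  suc n * (suc n C suc k) ∎
  where
  open ≡-Reasoning
  pascal = nCk+nC[k+1]≡[n+1]C[k+1]
  a = n C k
  b = n C suc k
  c = n C suc (suc k)
  regroup : ∀ k a b c → suc (suc k) * (b + c) + suc k * (a + b) ≡
                        (suc (suc k) * c + suc k * b) + (suc k * b + k * a) + (a + b)
  regroup = solve-∀
  collect : ∀ n a b → n * b + n * a + (a + b) ≡ suc n * (a + b)
  collect = solve-∀

x+j*b≡s*b⇒x+j*k≤s*k : ∀ {x j s b k} → j ≤ s → b ≤ k → x + j * b ≡ s * b → x + j * k ≤ s * k
x+j*b≡s*b⇒x+j*k≤s*k {x} {j} {s} {b} {k} j≤s b≤k eq with m≤n⇒∃[o]m+o≡n j≤s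
... | u , refl = begin
  x + j * k      ≡⟨ cong (_+ j * k) x≡u*b ⟩
  u * b + j * k  ≤⟨ +-monoˡ-≤ (j * k) (*-monoʳ-≤ u b≤k) ⟩
  u * k + j * k  ≡⟨ *-distribʳ-+ k u j ⟨
  (u + j) * k    ≡⟨ cong (_* k) (+-comm u j) ⟩
  (j + u) * k    ∎
  where
  open ≤-Reasoning
  x≡u*b : x ≡ u * b
  x≡u*b = +-cancelʳ-≡ (j * b) x (u * b) (trans eq (trans (*-distribʳ-+ b j u) (+-comm (j * b) (u * b))))

-- Double counting

sumOver : ∀ {m} → Subset m → (Fin m → ℕ) → ℕ
sumOver []            w = 0
sumOver (outside ∷ X) w = sumOver X (w ∘ suc)
sumOver (inside  ∷ X) w = w zero + sumOver X (w ∘ suc)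

sumOver-+ : ∀ {m} (X : Subset m) (v w : Fin m → ℕ) → sumOver X (λ y → v y + w y) ≡ sumOver X v + sumOver X w
sumOver-+ []            v w = refl
sumOver-+ (outside ∷ X) v w = sumOver-+ X (v ∘ suc) (w ∘ suc)
sumOver-+ (inside  ∷ X) v w =
  trans (cong (v zero + w zero +_) (sumOver-+ X (v ∘ suc) (w ∘ suc)))
        (interchange (v zero) (w zero) (sumOver X (v ∘ suc)) (sumOver X (w ∘ suc)))

sumOver-zero : ∀ {m} (X : Subset m) → sumOver X (λ _ → 0) ≡ 0
sumOver-zero []            = refl
sumOver-zero (outside ∷ X) = sumOver-zero X
sumOver-zero (inside  ∷ X) = sumOver-zero X

sumOver-lookup : ∀ {m} (X f : Subset m) → sumOver X (λ y → boolToℕ (lookup f y)) ≡ ∣ f ∩ X ∣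
sumOver-lookup []            []            = refl
sumOver-lookup (outside ∷ X) (outside ∷ f) = sumOver-lookup X f
sumOver-lookup (outside ∷ X) (inside  ∷ f) = sumOver-lookup X f
sumOver-lookup (inside  ∷ X) (outside ∷ f) = sumOver-lookup X f
sumOver-lookup (inside  ∷ X) (inside  ∷ f) = cong suc (sumOver-lookup X f)

sumOver-≥ : ∀ {m} (X : Subset m) {w : Fin m → ℕ} {k} → (∀ {y} → y ∈ X → k ≤ w y) → ∣ X ∣ * k ≤ sumOver X w
sumOver-≥ []            k≤w = z≤n
sumOver-≥ (outside ∷ X) k≤w = sumOver-≥ X (k≤w ∘ there)
sumOver-≥ (inside  ∷ X) k≤w = +-mono-≤ (k≤w here) (sumOver-≥ X (k≤w ∘ there))

sumOver-> : ∀ {m} (X : Subset m) {w : Fin m → ℕ} {k x} → (∀ {y} → y ∈ X → k ≤ w y) →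
            x ∈ X → k < w x → ∣ X ∣ * k < sumOver X w
sumOver-> (inside  ∷ X) k≤w here         k<w = +-mono-≤ k<w (sumOver-≥ X (k≤w ∘ there))
sumOver-> (inside  ∷ X) k≤w (there x∈X) k<w =
  ≤-trans (≤-reflexive (sym (+-suc _ _))) (+-mono-≤ (k≤w here) (sumOver-> X (k≤w ∘ there) x∈X k<w))
sumOver-> (outside ∷ X) k≤w (there x∈X) k<w = sumOver-> X (k≤w ∘ there) x∈X k<w

double-counting : ∀ {m} (X : Subset m) (g : Subset m → Bool) (L : List (Subset m)) →
                  sumOver X (λ y → count (λ f → g f ∧ lookup f y) L) ≡ ∑ (λ f → if g f then ∣ f ∩ X ∣ else 0) L
double-counting X g []      = sumOver-zero X
double-counting X g (f ∷ L) =
  trans (sumOver-+ X (λ y → boolToℕ (g f ∧ lookup f y)) (λ y → count (λ f → g f ∧ lookup f y) L))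
        (cong₂ _+_ (head-term (g f)) (double-counting X g L))
  where
  head-term : ∀ b → sumOver X (λ y → boolToℕ (b ∧ lookup f y)) ≡ (if b then ∣ f ∩ X ∣ else 0)
  head-term true  = sumOver-lookup X f
  head-term false = sumOver-zero X

-- Degrees and cuts in hypergraphs

deg : ∀ {m} → Hypergraph m → Fin m → ℕ
deg {m} H y = count (λ f → E H f ∧ lookup f y) (allSubsets m)

d≡count : ∀ {m} (H : Hypergraph m) X → d H X ≡ count (λ f → E H f ∧ crosses H X f) (allSubsets m)
d≡count {m} H X =
  trans (length-filter≡count (crosses H X) (edges H)) (count-filter (E H) (crosses H X) (allSubsets m))

module _ {m} (H : Hypergraph m) {X f : Subset m} where

  crosses⁺ : ∀ {x z} → x ∈ f → x ∈ X → z ∈ f → z ∈ V H → z ∉ X → crosses H X f ≡ true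
  crosses⁺ x∈f x∈X z∈f z∈V z∉X =
    isYes⁺ (nonempty? (f ∩ X) ×-dec nonempty? (f ∩ (V H ─ X)))
           ((_ , x∈p∩q⁺ (x∈f , x∈X)) , (_ , x∈p∩q⁺ (z∈f , x∈p∧x∉q⇒x∈p─q z∈V z∉X)))

  crosses⁻ : crosses H X f ≡ true → (∃ λ x → x ∈ f × x ∈ X) × (∃ λ z → z ∈ f × z ∈ V H × z ∉ X)
  crosses⁻ c with isYes⁻ (nonempty? (f ∩ X) ×-dec nonempty? (f ∩ (V H ─ X))) c
  ... | (x , x∈f∩X) , (z , z∈f∩[V─X]) with x∈p∩q⁻ f (V H ─ X) z∈f∩[V─X]
  ... | z∈f , z∈V─X = (x , x∈p∩q⁻ f X x∈f∩X) , (z , z∈f , p─q⊆p (V H) X z∈V─X , x∈p─q⇒x∉q (V H) X z∈V─X)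

  ⊆⇒¬crosses : f ⊆ X → crosses H X f ≡ false
  ⊆⇒¬crosses f⊆X with crosses H X f in c
  ... | false = refl
  ... | true with crosses⁻ c
  ...   | _ , (z , z∈f , _ , z∉X) = contradiction (f⊆X z∈f) z∉X

module _ {m r} {H : Hypergraph m} (uniform : Uniform r H) where

  edge-⊈ : ∀ {f Y} → E H f ≡ true → ∣ Y ∣ < r → ∃ λ z → z ∈ f × z ∉ Y
  edge-⊈ f∈E ∣Y∣<r = ∣q∣<∣p∣⇒∃∈p∉q (subst (_ <_) (sym (proj₁ (proj₂ (uniform _ f∈E)))) ∣Y∣<r)

  edge-crosses : ∀ {f X x} → E H f ≡ true → x ∈ f → x ∈ X → ∣ X ∣ < r → crosses H X f ≡ true
  edge-crosses f∈E x∈f x∈X ∣X∣<r with edge-⊈ f∈E ∣X∣<r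
  ... | z , z∈f , z∉X = crosses⁺ H x∈f x∈X z∈f (proj₁ (uniform _ f∈E) z∈f) z∉X

edge-∩-bound : ∀ {m j} {H : Hypergraph m} → Uniform (suc j) H → ∀ X f →
               (if E H f then ∣ f ∩ X ∣ else 0) ≤
               suc j * boolToℕ (E H f ∧ does (f ⊆? X)) + j * boolToℕ (E H f ∧ crosses H X f)
edge-∩-bound {j = j} {H} uniform X f with E H f in f∈E
... | false = z≤n
... | true with uniform f f∈E | f ⊆? X
...   | _ , ∣f∣≡1+j , _ | yes f⊆X = begin
  ∣ f ∩ X ∣                                   ≤⟨ ∣p∩q∣≤∣p∣ f X ⟩
  ∣ f ∣                                       ≡⟨ trans ∣f∣≡1+j (sym (*-identityʳ (suc j))) ⟩
  suc j * 1                                   ≤⟨ m≤m+n _ _ ⟩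
  suc j * 1 + j * boolToℕ (crosses H X f)     ∎
  where open ≤-Reasoning
...   | f⊆V , ∣f∣≡1+j , _ | no f⊈X with p⊈q⇒∃∈p∉q f⊈X | crosses H X f in f-crosses
...     | z , z∈f , z∉X | true = begin
  ∣ f ∩ X ∣           ≤⟨ s≤s⁻¹ (≤-trans ∣f∩X∣<∣f∣ (≤-reflexive ∣f∣≡1+j)) ⟩
  j                   ≡⟨ trans (cong (_+ j * 1) (*-zeroʳ (suc j))) (*-identityʳ j) ⟨
  suc j * 0 + j * 1   ∎
  where
  open ≤-Reasoning
  ∣f∩X∣<∣f∣ : ∣ f ∩ X ∣ < ∣ f ∣
  ∣f∩X∣<∣f∣ = p⊂q⇒∣p∣<∣q∣ (p∩q⊆p f X , z , z∈f , z∉X ∘ proj₂ ∘ x∈p∩q⁻ f X)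
...     | z , z∈f , z∉X | false = subst (_≤ _) (sym (Empty⇒∣p∣≡0 f∩X-empty)) z≤n
  where
  f∩X-empty : ¬ Nonempty (f ∩ X)
  f∩X-empty (x , x∈f∩X) with x∈p∩q⁻ f X x∈f∩X
  ... | x∈f , x∈X = contradiction (trans (sym (crosses⁺ H x∈f x∈X z∈f (f⊆V z∈f) z∉X)) f-crosses) λ ()

κ'≥⇒deg≥ : ∀ {m k} (H : Hypergraph m) → κ'≥ H k → 2 ≤ ∣ V H ∣ → ∀ {y} → y ∈ V H → k ≤ deg H y
κ'≥⇒deg≥ {m} {k} H κ'≥k 2≤∣V∣ {y} y∈V = begin
  k                                                       ≤⟨ κ'≥k ⁅ y ⁆ (⁅y⁆⊆V , (y , x∈⁅x⁆ y) , V─⁅y⁆≢∅) ⟩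
  d H ⁅ y ⁆                                               ≡⟨ d≡count H ⁅ y ⁆ ⟩
  count (λ f → E H f ∧ crosses H ⁅ y ⁆ f) (allSubsets m)  ≤⟨ count-mono through-y (allSubsets m) ⟩
  deg H y                                                 ∎
  where
  open ≤-Reasoning
  ⁅y⁆⊆V : ⁅ y ⁆ ⊆ V H
  ⁅y⁆⊆V z∈⁅y⁆ = subst (_∈ V H) (sym (x∈⁅y⁆⇒x≡y y z∈⁅y⁆)) y∈V
  V─⁅y⁆≢∅ : Nonempty (V H ─ ⁅ y ⁆)
  V─⁅y⁆≢∅ with nonempty? (V H ─ ⁅ y ⁆)
  ... | yes ne    = ne
  ... | no  empty = contradiction (≤-trans 2≤∣V∣ (≤-trans (p⊆q⇒∣p∣≤∣q∣ (Empty[p─q]⇒p⊆q empty))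
                                                            (≤-reflexive (∣⁅x⁆∣≡1 y))))
                                  λ { (s≤s ()) }
  through-y : ∀ f → E H f ∧ crosses H ⁅ y ⁆ f ≡ true → E H f ∧ lookup f y ≡ true
  through-y f h with ∧-true⁻ (E H f) h
  ... | f∈E , f-crosses with crosses⁻ H f-crosses
  ... | (x , x∈f , x∈⁅y⁆) , _ rewrite x∈⁅y⁆⇒x≡y y x∈⁅y⁆ = ∧-true⁺ f∈E ([]=⇒lookup x∈f)

module _ {m} {H H'' : Hypergraph m} {e : Subset m} (sub : Sub H'' (addEdge H e)) where

  edge-addEdge⁻ : ∀ {f} → E H'' f ≡ true → E H f ≡ true ⊎ f ≡ e
  edge-addEdge⁻ {f} f∈E'' with ∨-true⁻ (proj₁ (proj₂ sub f f∈E''))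
  ... | inj₁ f∈E = inj₁ f∈E
  ... | inj₂ f≡e = inj₂ (isYes⁻ (≡-dec B._≟_ f e) f≡e)

  deg-addEdge : ∀ y → deg H'' y ≤ deg H y + 1
  deg-addEdge y = count-≤-+1 e through-y
    where
    through-y : ∀ f → E H'' f ∧ lookup f y ≡ true → E H f ∧ lookup f y ≡ true ⊎ f ≡ e
    through-y f h with ∧-true⁻ (E H'' f) h
    ... | f∈E'' , y∈f with edge-addEdge⁻ f∈E''
    ...   | inj₁ f∈E = inj₁ (∧-true⁺ f∈E y∈f)
    ...   | inj₂ f≡e = inj₂ f≡e

  deg-addEdge-∉ : ∀ {y} → y ∉ e → deg H'' y ≤ deg H y
  deg-addEdge-∉ {y} y∉e = count-mono through-y (allSubsets m)
    where
    through-y : ∀ f → E H'' f ∧ lookup f y ≡ true → E H f ∧ lookup f y ≡ true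
    through-y f h with ∧-true⁻ (E H'' f) h
    ... | f∈E'' , y∈f with edge-addEdge⁻ f∈E''
    ...   | inj₁ f∈E  = ∧-true⁺ f∈E y∈f
    ...   | inj₂ refl = contradiction (lookup⇒[]= y f y∈f) y∉e

  d-restrict : ∀ {X} → e ⊆ X → d H'' (X ∩ V H'') ≤ d H X
  d-restrict {X} e⊆X = begin
    d H'' Y                                                  ≡⟨ d≡count H'' Y ⟩
    count (λ f → E H'' f ∧ crosses H'' Y f) (allSubsets m)   ≤⟨ count-mono crosses-X (allSubsets m) ⟩
    count (λ f → E H f ∧ crosses H X f) (allSubsets m)       ≡⟨ d≡count H X ⟨
    d H X                                                    ∎
    where
    open ≤-Reasoning
    Y = X ∩ V H''
    crosses-X : ∀ f → E H'' f ∧ crosses H'' Y f ≡ true → E H f ∧ crosses H X f ≡ true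
    crosses-X f h with ∧-true⁻ (E H'' f) h
    ... | f∈E'' , f-crosses-Y with crosses⁻ H'' f-crosses-Y | edge-addEdge⁻ f∈E''
    ...   | _ , (b , b∈f , b∈V'' , b∉Y) | inj₂ refl = contradiction (x∈p∩q⁺ (e⊆X b∈f , b∈V'')) b∉Y
    ...   | (a , a∈f , a∈Y) , (b , b∈f , b∈V'' , b∉Y) | inj₁ f∈E =
      ∧-true⁺ f∈E (crosses⁺ H a∈f (proj₁ (x∈p∩q⁻ X (V H'') a∈Y)) b∈f (proj₁ sub b∈V'')
                              (λ b∈X → b∉Y (x∈p∩q⁺ (b∈X , b∈V''))))

complete-through⇒C≤count : ∀ {m} {p : Subset m → Bool} (A : Subset m) j {y} → y ∈ A →
                           (∀ e → e ⊆ A → ∣ e ∣ ≡ suc j → y ∈ e → p e ≡ true) →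
                           pred ∣ A ∣ C j ≤ count p (allSubsets m)
complete-through⇒C≤count {m} {p} A j {y} y∈A all = begin
  pred ∣ A ∣ C j                                               ≡⟨ count-inChoose-∋ A j y∈A ⟨
  count (λ s → inChoose A (suc j) s ∧ lookup s y) (allSubsets m) ≤⟨ count-mono chosen⇒p (allSubsets m) ⟩
  count p (allSubsets m)                                       ∎
  where
  open ≤-Reasoning
  chosen⇒p : ∀ s → inChoose A (suc j) s ∧ lookup s y ≡ true → p s ≡ true
  chosen⇒p s h with ∧-true⁻ (inChoose A (suc j) s) h
  ... | chosen , y∈s with inChoose⁻ chosen
  ...   | s⊆A , ∣s∣≡1+j = all s s⊆A ∣s∣≡1+j (lookup⇒[]= y s y∈s)

nonEdge-or-complete : ∀ {m} (H : Hypergraph m) (A : Subset m) r y →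
                      (∃ λ e → e ⊆ A × ∣ e ∣ ≡ r × y ∈ e × E H e ≡ false)
                      ⊎ (∀ e → e ⊆ A → ∣ e ∣ ≡ r → y ∈ e → E H e ≡ true)
nonEdge-or-complete H A r y with anySubset? (λ e → e ⊆? A ×-dec ∣ e ∣ ≟ r ×-dec y ∈? e ×-dec E H e B.≟ false)
... | yes nonEdge = inj₁ nonEdge
... | no  none    = inj₂ λ e e⊆A ∣e∣≡r y∈e → ¬-not λ e∉E → none (e , e⊆A , ∣e∣≡r , y∈e , e∉E)

no-edge-inside-small : ∀ {m r} {H : Hypergraph m} → Uniform r H → ∀ {X} → ∣ X ∣ < r → ∀ e → e ⊆ X → E H e ≡ false
no-edge-inside-small {H = H} uniform ∣X∣<r e e⊆X with E H e in e∈E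
... | false = refl
... | true  = contradiction (≤-trans (≤-reflexive (sym (proj₁ (proj₂ (uniform e e∈E))))) (p⊆q⇒∣p∣≤∣q∣ e⊆X))
                            (<⇒≱ ∣X∣<r)

edges-inside≤ : ∀ {m r} {H : Hypergraph m} → Uniform r H → ∀ X →
                count (λ f → E H f ∧ does (f ⊆? X)) (allSubsets m) ≤ ∣ X ∣ C r
edges-inside≤ {m} {r} {H} uniform X = ≤-trans (count-mono chosen (allSubsets m)) (≤-reflexive (count-inChoose X r))
  where
  chosen : ∀ f → E H f ∧ does (f ⊆? X) ≡ true → inChoose X r f ≡ true
  chosen f h with ∧-true⁻ (E H f) h
  ... | f∈E , f⊆X = ∧-true⁺ f⊆X (does⁺ (∣ f ∣ ≟ r) (proj₁ (proj₂ (uniform f f∈E))))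

κ'≤⇒¬κ'≥suc : ∀ {m k} {H : Hypergraph m} → κ'≤ H k → ¬ κ'≥ H (suc k)
κ'≤⇒¬κ'≥suc (X , proper , dX≤k) κ'≥1+k = n≮n _ (≤-trans (κ'≥1+k X proper) dX≤k)

-- Edge-maximal hypergraphs

record Extension {m} (k l : ℕ) (H : Hypergraph m) (e : Subset m) : Set where
  field
    graph     : Hypergraph m
    sub       : Sub graph (addEdge H e)
    large     : l ≤ ∣ V graph ∣
    connected : κ'≥ graph (suc k)
    uses-e    : E graph e ≡ true

open Extension

module EdgeMaximality {m k l j t} {H : Hypergraph m} (maximal : EdgeMaximal k l (suc j) H)
                      (isT : IsT k (suc j) t) (t<n : t < ∣ V H ∣) (2≤l : 2 ≤ l) where

  uniform : Uniform (suc j) H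
  uniform = proj₁ maximal

  extension : ∀ {e} → e ⊆ V H → ∣ e ∣ ≡ suc j → E H e ≡ false → Extension k l H e
  extension {e} e⊆V ∣e∣≡1+j e∉E with proj₂ (proj₂ maximal) e e⊆V ∣e∣≡1+j e∉E
  ... | H'' , sub'' , large'' , connected'' with E H'' e in e∈E''
  ...   | true  = record { graph = H'' ; sub = sub'' ; large = large'' ; connected = connected'' ; uses-e = e∈E'' }
  ...   | false = ⊥-elim (κ'≤⇒¬κ'≥suc (proj₁ (proj₂ maximal) H'' sub-H large'') connected'')
    where
    edge-of-H : ∀ {f} → E H'' f ≡ true → E H f ≡ true ⊎ f ≡ e → E H f ≡ true
    edge-of-H _      (inj₁ f∈E) = f∈E
    edge-of-H f∈E'' (inj₂ refl) = contradiction (trans (sym f∈E'') e∈E'') λ ()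
    sub-H : Sub H'' H
    sub-H = proj₁ sub'' , λ f f∈E'' → edge-of-H f∈E'' (edge-addEdge⁻ sub'' f∈E'') , proj₂ (proj₂ sub'' f f∈E'')

  extension-deg : ∀ {e} (ext : Extension k l H e) → ∀ {y} → y ∈ V (graph ext) → k < deg (graph ext) y
  extension-deg ext = κ'≥⇒deg≥ (graph ext) (connected ext) (≤-trans 2≤l (large ext))

  e⊆extension : ∀ {e} (ext : Extension k l H e) → e ⊆ V (graph ext)
  e⊆extension {e} ext = proj₂ (proj₂ (sub ext) e (uses-e ext))

  complete-through⇒deg>k : ∀ {y} → y ∈ V H → (∀ e → e ⊆ V H → ∣ e ∣ ≡ suc j → y ∈ e → E H e ≡ true) →
                           k < deg H y
  complete-through⇒deg>k {y} y∈V complete = begin-strict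
    k                <⟨ proj₂ isT ⟩
    t C j            ≤⟨ C-monoˡ-≤ j (<⇒≤pred t<n) ⟩
    pred ∣ V H ∣ C j ≤⟨ complete-through⇒C≤count (V H) j y∈V edge-through-y ⟩
    deg H y          ∎
    where
    open ≤-Reasoning
    edge-through-y : ∀ e → e ⊆ V H → ∣ e ∣ ≡ suc j → y ∈ e → E H e ∧ lookup e y ≡ true
    edge-through-y e e⊆V ∣e∣≡1+j y∈e = ∧-true⁺ (complete e e⊆V ∣e∣≡1+j y∈e) ([]=⇒lookup y∈e)

  k≤deg : ∀ {y} → y ∈ V H → k ≤ deg H y
  k≤deg {y} y∈V with nonEdge-or-complete H (V H) (suc j) y
  ... | inj₂ complete                      = <⇒≤ (complete-through⇒deg>k y∈V complete)
  ... | inj₁ (e , e⊆V , ∣e∣≡1+j , y∈e , e∉E) = s≤s⁻¹ (begin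
    suc k                  ≤⟨ extension-deg ext (e⊆extension ext y∈e) ⟩
    deg (graph ext) y      ≤⟨ deg-addEdge (sub ext) y ⟩
    deg H y + 1            ≡⟨ +-comm (deg H y) 1 ⟩
    suc (deg H y)          ∎)
    where
    open ≤-Reasoning
    ext = extension e⊆V ∣e∣≡1+j e∉E

  module _ {X : Subset m} (proper : ProperNonempty H X) (dX≡k : d H X ≡ k) where

    X⊆V : X ⊆ V H
    X⊆V = proj₁ proper

    crossing≡k : count (λ f → E H f ∧ crosses H X f) (allSubsets m) ≡ k
    crossing≡k = trans (sym (d≡count H X)) dX≡k

    small⇒X⊆crossing-edge : ∣ X ∣ < suc j → ∀ f → E H f ≡ true → crosses H X f ≡ true → X ⊆ f
    small⇒X⊆crossing-edge ∣X∣<r f f∈E f-crosses {x} x∈X =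
      lookup⇒[]= x f (proj₂ (∧-true⁻ (E H f)
        (count-≤⇒converse (allSubsets m) through⇒crossing crossing≤deg (∈-allSubsets f) (∧-true⁺ f∈E f-crosses))))
      where
      through⇒crossing : ∀ g → E H g ∧ lookup g x ≡ true → E H g ∧ crosses H X g ≡ true
      through⇒crossing g h with ∧-true⁻ (E H g) h
      ... | g∈E , x∈g = ∧-true⁺ g∈E (edge-crosses uniform g∈E (lookup⇒[]= x g x∈g) x∈X ∣X∣<r)
      crossing≤deg : count (λ g → E H g ∧ crosses H X g) (allSubsets m) ≤ deg H x
      crossing≤deg = ≤-trans (≤-reflexive crossing≡k) (k≤deg (X⊆V x∈X))

    -- Otherwise X ∩ V(H'') would be a cut of H'' with at most d_H(X) = k crossing edges.
    extension-within : ∀ {e} → e ⊆ X → ∣ e ∣ ≡ suc j → (ext : Extension k l H e) → V (graph ext) ⊆ X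
    extension-within {e} e⊆X ∣e∣≡1+j ext = Empty[p─q]⇒p⊆q outside-empty
      where
      Y = X ∩ V (graph ext)
      Y-nonempty : Nonempty Y
      Y-nonempty with 0<∣p∣⇒Nonempty {p = e} (subst (0 <_) (sym ∣e∣≡1+j) (s≤s z≤n))
      ... | z , z∈e = z , x∈p∩q⁺ (e⊆X z∈e , e⊆extension ext z∈e)
      outside-empty : ¬ Nonempty (V (graph ext) ─ X)
      outside-empty (w , w∈V''─X) = n≮n k (begin-strict
        k                <⟨ connected ext Y (p∩q⊆q X _ , Y-nonempty , (w , x∈p∧x∉q⇒x∈p─q w∈V'' w∉Y)) ⟩
        d (graph ext) Y  ≤⟨ d-restrict (sub ext) e⊆X ⟩
        d H X            ≡⟨ dX≡k ⟩
        k                ∎)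
        where
        open ≤-Reasoning
        w∈V'' = p─q⊆p _ X w∈V''─X
        w∉Y : w ∉ Y
        w∉Y w∈Y = x∈p─q⇒x∉q _ X w∈V''─X (proj₁ (x∈p∩q⁻ X _ w∈Y))

    small⇒complete : ∣ X ∣ < l → ∀ e → e ⊆ X → ∣ e ∣ ≡ suc j → E H e ≡ true
    small⇒complete ∣X∣<l e e⊆X ∣e∣≡1+j with E H e in e∈E
    ... | true  = refl
    ... | false = contradiction (≤-trans (large ext) (p⊆q⇒∣p∣≤∣q∣ (extension-within e⊆X ∣e∣≡1+j ext))) (<⇒≱ ∣X∣<l)
      where
      ext = extension (λ z∈e → X⊆V (e⊆X z∈e)) ∣e∣≡1+j e∈E

    large⇒edgeMaximal : l ≤ ∣ X ∣ → EdgeMaximal k l (suc j) (induced H X)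
    large⇒edgeMaximal _ = uniform[X] , sparse[X] , saturated[X]
      where
      uniform[X] : Uniform (suc j) (induced H X)
      uniform[X] e h with ∧-true⁻ (E H e) h
      ... | e∈E , e⊆X with uniform e e∈E
      ...   | _ , ∣e∣≡1+j , e≢∅ = isYes⁻ (e ⊆? X) e⊆X , ∣e∣≡1+j , e≢∅
      sparse[X] : ∀ H' → Sub H' (induced H X) → l ≤ ∣ V H' ∣ → κ'≤ H' k
      sparse[X] H' (V'⊆X , edges⊆) = proj₁ (proj₂ maximal) H'
        ((λ z∈V' → X⊆V (V'⊆X z∈V')) ,
         λ f f∈E' → proj₁ (∧-true⁻ (E H f) (proj₁ (edges⊆ f f∈E'))) , proj₂ (edges⊆ f f∈E'))
      saturated[X] : ∀ e → e ⊆ X → ∣ e ∣ ≡ suc j → E (induced H X) e ≡ false →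
                     Σ (Hypergraph m) λ H'' → Sub H'' (addEdge (induced H X) e) × l ≤ ∣ V H'' ∣ × κ'≥ H'' (suc k)
      saturated[X] e e⊆X ∣e∣≡1+j e∉E[X] = graph ext , (V''⊆X , edges⊆) , large ext , connected ext
        where
        e∉E : E H e ≡ false
        e∉E with E H e
        ... | false = refl
        ... | true  = contradiction (trans (sym (isYes⁺ (e ⊆? X) e⊆X)) e∉E[X]) λ ()
        ext = extension (λ z∈e → X⊆V (e⊆X z∈e)) ∣e∣≡1+j e∉E
        V''⊆X = extension-within e⊆X ∣e∣≡1+j ext
        edge-of-addEdge : ∀ {f} → f ⊆ X → E H f ≡ true ⊎ f ≡ e → E (addEdge (induced H X) e) f ≡ true
        edge-of-addEdge {f} f⊆X (inj₁ f∈E) rewrite f∈E | isYes⁺ (f ⊆? X) f⊆X = refl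
        edge-of-addEdge {f} f⊆X (inj₂ refl) rewrite isYes⁺ (≡-dec B._≟_ f f) refl = ∨-zeroʳ _
        edges⊆ : ∀ f → E (graph ext) f ≡ true → E (addEdge (induced H X) e) f ≡ true × f ⊆ V (graph ext)
        edges⊆ f f∈E'' = edge-of-addEdge (λ z∈f → V''⊆X (f⊆V'' z∈f)) (edge-addEdge⁻ (sub ext) f∈E'') , f⊆V''
          where f⊆V'' = proj₂ (proj₂ (sub ext) f f∈E'')

    degree-sum≤ : j ≤ ∣ X ∣ → ∣ X ∣ < t → sumOver X (deg H) ≤ ∣ X ∣ * k
    degree-sum≤ j≤∣X∣ ∣X∣<t = begin
      sumOver X (deg H)
        ≡⟨ double-counting X (E H) S ⟩
      ∑ (λ f → if E H f then ∣ f ∩ X ∣ else 0) S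
        ≤⟨ ∑-mono-≤ (edge-∩-bound uniform X) S ⟩
      ∑ (λ f → suc j * boolToℕ (E H f ∧ does (f ⊆? X)) + j * boolToℕ (E H f ∧ crosses H X f)) S
        ≡⟨ trans (∑-+ _ _ S) (cong₂ _+_ (∑-* (suc j) _ S) (∑-* j _ S)) ⟩
      suc j * count (λ f → E H f ∧ does (f ⊆? X)) S + j * count (λ f → E H f ∧ crosses H X f) S
        ≤⟨ +-mono-≤ (*-monoʳ-≤ (suc j) (edges-inside≤ uniform X)) (≤-reflexive (cong (j *_) crossing≡k)) ⟩
      suc j * (∣ X ∣ C suc j) + j * k
        ≤⟨ x+j*b≡s*b⇒x+j*k≤s*k j≤∣X∣ (≤-trans (C-monoˡ-≤ j (<⇒≤pred ∣X∣<t)) (proj₁ isT))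
                               ([k+1]*nC[k+1]+k*nCk≡n*nCk ∣ X ∣ j) ⟩
      ∣ X ∣ * k ∎
      where
      open ≤-Reasoning
      S = allSubsets m

    crossingDeg innerDeg : Fin m → ℕ
    crossingDeg x = count (λ f → (E H f ∧ lookup f x) ∧ crosses H X f) (allSubsets m)
    innerDeg    x = count (λ f → (E H f ∧ lookup f x) ∧ not (crosses H X f)) (allSubsets m)

    module _ (r≤∣X∣ : suc j ≤ ∣ X ∣) (∣X∣<l : ∣ X ∣ < l) where

      0<innerDeg : ∀ {x} → x ∈ X → 0 < innerDeg x
      0<innerDeg {x} x∈X = begin-strict
        0              <⟨ k≤n⇒0<nCk j (<⇒≤pred r≤∣X∣) ⟩
        pred ∣ X ∣ C j ≤⟨ complete-through⇒C≤count X j x∈X inner-edge ⟩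
        innerDeg x     ∎
        where
        open ≤-Reasoning
        inner-edge : ∀ e → e ⊆ X → ∣ e ∣ ≡ suc j → x ∈ e → (E H e ∧ lookup e x) ∧ not (crosses H X e) ≡ true
        inner-edge e e⊆X ∣e∣≡1+j x∈e =
          ∧-true⁺ (∧-true⁺ (small⇒complete ∣X∣<l e e⊆X ∣e∣≡1+j) ([]=⇒lookup x∈e)) (cong not (⊆⇒¬crosses H e⊆X))

      -- X ∩ V(H'') ⊊ e because the non-edge e cannot lie in the complete X; so every edge of H''
      -- through x other than e leaves X ∩ V(H''), hence leaves X.
      k≤crossingDeg : ∀ {x e} → x ∈ X → x ∈ e → ∣ e ∣ ≡ suc j → E H e ≡ false →
                      (ext : Extension k l H e) → X ∩ V (graph ext) ⊆ e → k ≤ crossingDeg x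
      k≤crossingDeg {x} {e} x∈X x∈e ∣e∣≡1+j e∉E ext Y⊆e = s≤s⁻¹ (begin
        suc k              ≤⟨ extension-deg ext (e⊆extension ext x∈e) ⟩
        deg (graph ext) x  ≤⟨ count-≤-+1 e crossing-or-e ⟩
        crossingDeg x + 1  ≡⟨ +-comm (crossingDeg x) 1 ⟩
        suc (crossingDeg x) ∎)
        where
        open ≤-Reasoning
        Y = X ∩ V (graph ext)
        e⊈X : ¬ (e ⊆ X)
        e⊈X e⊆X = contradiction (trans (sym (small⇒complete ∣X∣<l e e⊆X ∣e∣≡1+j)) e∉E) λ ()
        ∣Y∣<r : ∣ Y ∣ < suc j
        ∣Y∣<r with p⊈q⇒∃∈p∉q e⊈X
        ... | z , z∈e , z∉X = subst (∣ Y ∣ <_) ∣e∣≡1+j (p⊂q⇒∣p∣<∣q∣ (Y⊆e , z , z∈e , z∉X ∘ proj₁ ∘ x∈p∩q⁻ X _))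
        crossing-or-e : ∀ f → E (graph ext) f ∧ lookup f x ≡ true →
                        (E H f ∧ lookup f x) ∧ crosses H X f ≡ true ⊎ f ≡ e
        crossing-or-e f h with ∧-true⁻ (E (graph ext) f) h
        ... | f∈E'' , x∈f with edge-addEdge⁻ (sub ext) f∈E''
        ...   | inj₂ f≡e = inj₂ f≡e
        ...   | inj₁ f∈E with edge-⊈ uniform f∈E ∣Y∣<r
        ...     | b , b∈f , b∉Y = inj₁ (∧-true⁺ (∧-true⁺ f∈E x∈f)
          (crosses⁺ H (lookup⇒[]= x f x∈f) x∈X b∈f (proj₁ (sub ext) b∈V'') λ b∈X → b∉Y (x∈p∩q⁺ (b∈X , b∈V''))))
          where
          b∈V'' = proj₂ (proj₂ (sub ext) f f∈E'') b∈f

      deg>k-near-nonEdge : ∀ {x e} → x ∈ X → x ∈ e → ∣ e ∣ ≡ suc j → E H e ≡ false →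
                           Extension k l H e → ∃ λ y → y ∈ X × k < deg H y
      deg>k-near-nonEdge {x} {e} x∈X x∈e ∣e∣≡1+j e∉E ext with nonempty? (X ∩ V (graph ext) ─ e)
      ... | yes (y , y∈Y─e) = y , proj₁ y∈X×V'' , (begin-strict
        k                  <⟨ extension-deg ext (proj₂ y∈X×V'') ⟩
        deg (graph ext) y  ≤⟨ deg-addEdge-∉ (sub ext) (x∈p─q⇒x∉q _ e y∈Y─e) ⟩
        deg H y            ∎)
        where
        open ≤-Reasoning
        y∈X×V'' = x∈p∩q⁻ X _ (p─q⊆p _ e y∈Y─e)
      ... | no  Y─e-empty  = x , x∈X , (begin
        suc k                     ≡⟨ +-comm 1 k ⟩
        k + 1                     ≤⟨ +-mono-≤ (k≤crossingDeg x∈X x∈e ∣e∣≡1+j e∉E ext (Empty[p─q]⇒p⊆q Y─e-empty))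
                                              (0<innerDeg x∈X) ⟩
        crossingDeg x + innerDeg x ≡⟨ count-split (λ f → E H f ∧ lookup f x) (crosses H X) (allSubsets m) ⟨
        deg H x                   ∎)
        where open ≤-Reasoning

      ∃deg>k : ∃ λ x → x ∈ X × k < deg H x
      ∃deg>k with proj₁ (proj₂ proper)
      ... | x , x∈X with nonEdge-or-complete H (V H) (suc j) x
      ...   | inj₂ complete                      = x , x∈X , complete-through⇒deg>k (X⊆V x∈X) complete
      ...   | inj₁ (e , e⊆V , ∣e∣≡1+j , x∈e , e∉E) =
        deg>k-near-nonEdge x∈X x∈e ∣e∣≡1+j e∉E (extension e⊆V ∣e∣≡1+j e∉E)

      t≤∣X∣ : t ≤ ∣ X ∣
      t≤∣X∣ with ∃deg>k
      ... | x , x∈X , k<deg = ≮⇒≥ λ ∣X∣<t →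
        <⇒≱ (sumOver-> X (λ y∈X → k≤deg (X⊆V y∈X)) x∈X k<deg) (degree-sum≤ (<⇒≤ r≤∣X∣) ∣X∣<t)

lemma2p2 : (m k l r t : ℕ) (H : Hypergraph m) →
    2 ≤ k → 2 ≤ r → IsT k r t → suc t ≤ l → l ≤ ∣ V H ∣ →
    EdgeMaximal k l r H →
    (X : Subset m) → ProperNonempty H X → d H X ≡ k →
    ((∣ X ∣ ≤ r ∸ 1 →
        (∀ e → e ⊆ X → E H e ≡ false)
        × (∀ e → E H e ≡ true → crosses H X e ≡ true → X ⊆ e))
    × (r ≤ ∣ X ∣ → ∣ X ∣ ≤ l ∸ 1 →
        (∀ e → e ⊆ X → ∣ e ∣ ≡ r → E H e ≡ true) × t ≤ ∣ X ∣)
    × (l ≤ ∣ X ∣ → EdgeMaximal k l r (induced H X)))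
lemma2p2 m k l zero                t H _ ()        _        _ _ _ _ _ _
lemma2p2 m k l (suc zero)          t H _ (s≤s ()) _        _ _ _ _ _ _
lemma2p2 m k l (suc (suc j))       zero H _ _      (_ , ()) _ _ _ _ _ _
lemma2p2 m k (suc l) (suc (suc j)) (suc t) H _ _ isT (s≤s 1+t≤l) l<n maximal X proper dX≡k =
    (λ ∣X∣≤1+j → no-edge-inside-small uniform (s≤s ∣X∣≤1+j) , small⇒X⊆crossing-edge proper dX≡k (s≤s ∣X∣≤1+j))
  , (λ r≤∣X∣ ∣X∣≤l → small⇒complete proper dX≡k (s≤s ∣X∣≤l) , t≤∣X∣ proper dX≡k r≤∣X∣ (s≤s ∣X∣≤l))
  , large⇒edgeMaximal proper dX≡k
  where
  open EdgeMaximality maximal isT (≤-trans (s≤s 1+t≤l) l<n) (s≤s (≤-trans (s≤s z≤n) 1+t≤l))
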